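{- Let $G$ be a $d$-regular digraph with a walk cover $W$, and for each $k$ let $w_k(G)$ be the number of walks of length $k$ in $W$. Consider the associated walk cover of the directed line graph $L(G)$: for every ordered pair of vertices $e=(u,v)$, $f=(w,x)$ of $L(G)$, it contains the walk $e\,P\,f$, where $P$ is the walk in $W$ from $v$ to $w$. Let $w_{k}(L)$ be the number of walks of length $k$ in this associated walk cover. Then $w_{k+1}(L)=d^2\,w_k(G)$ for every $k$.
   Context: A digraph (multiple edges allowed) is $d$-regular if every vertex has in-degree and out-degree $d$. Walks may repeat vertices and edges; the length of a walk is its number of edges (a single vertex is a walk of length $0$). A walk cover of $G$ is a set $W$ of walks such that for every ordered pair of vertices $(u,v)$, where $u=v$ is allowed, $W$ contains exactly one walk from $u$ to $v$. The directed line graph $L(G)$ of $G=(V,E)$ has vertex set $E$ and a directed edge from $(u,v)$ to $(v,w)$ for every pair of edges $(u,v),(v,w)\in E$. If $P$ traverses the edges $p_1,\dots,p_k$ of $G$ in order, then $e\,P\,f$ denotes the walk in $L(G)$ visiting the vertices $e,p_1,\dots,p_k,f$ in order, which has length $k+1$. -}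

module Defs where

open import Data.Nat using (ℕ; zero; suc; _≟_)
open import Data.Fin using (Fin) renaming (_≟_ to _≟ᶠ_)
open import Data.Product using (Σ; _×_; _,_; proj₁; proj₂)
open import Data.List using (List; length; filter; allFin; cartesianProduct)
open import Relation.Binary.PropositionalEquality using (_≡_; refl; sym)

record Digraph : Set₁ where
  constructor mkDigraph
  field
    V   : Set
    E   : Set
    src : E → V
    tgt : E → V
open Digraph public

data Walk (G : Digraph) : V G → V G → Set where
  nil  : ∀ {u} → Walk G u u
  cons : ∀ {u v} (e : E G) → src G e ≡ u → Walk G (tgt G e) v → Walk G u v

len : ∀ {G u v} → Walk G u v → ℕ
len nil          = 0
len (cons _ _ p) = suc (len p)

-- A walk cover: exactly one walk for every ordered pair (u , v) (u = v allowed),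
-- i.e. a choice function.
WalkCover : Digraph → Set
WalkCover G = (u v : V G) → Walk G u v

FinDigraph : (n m : ℕ) → (Fin m → Fin n) → (Fin m → Fin n) → Digraph
FinDigraph n m s t = mkDigraph (Fin n) (Fin m) s t

Regular : ∀ {n m} → (s t : Fin m → Fin n) → ℕ → Set
Regular {n} {m} s t d =
  (v : Fin n) → (length (filter (λ e → s e ≟ᶠ v) (allFin m)) ≡ d)
              × (length (filter (λ e → t e ≟ᶠ v) (allFin m)) ≡ d)

LineGraph : Digraph → Digraph
LineGraph G = mkDigraph (E G)
  (Σ (E G × E G) (λ ef → tgt G (proj₁ ef) ≡ src G (proj₂ ef)))
  (λ x → proj₁ (proj₁ x)) (λ x → proj₂ (proj₁ x))

ePf : ∀ {G w} (e : E G) → Walk G (tgt G e) w → (f : E G) → src G f ≡ w →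
      Walk (LineGraph G) e f
ePf e nil f q = cons ((e , f) , sym q) refl nil
ePf e (cons p r P) f q = cons ((e , p) , sym r) refl (ePf p P f q)

lineCover : ∀ {G} → WalkCover G → WalkCover (LineGraph G)
lineCover {G} W e f = ePf e (W (tgt G e) (src G f)) f refl

wCount : ∀ {G} (n : ℕ) → (Fin n → V G) → WalkCover G → ℕ → ℕ
wCount n vtx W k = length (filter (λ uv → len (W (vtx (proj₁ uv)) (vtx (proj₂ uv))) ≟ k)
                                  (cartesianProduct (allFin n) (allFin n)))

module Submission where

open import Defs
open import Data.Fin using (Fin; zero; suc) renaming (_≟_ to _≟ᶠ_)
open import Data.Fin.Properties using () renaming (suc-injective to fsuc-injective)
open import Data.List using (List; _++_; length; filter; map; tabulate; allFin; cartesianProduct)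
open import Data.List.Properties using (filter-++; length-++; map-tabulate)
open import Data.Nat using (ℕ; zero; suc; _+_; _*_; _^_; _≟_)
open import Data.Nat.Properties using (+-*-semiring; +-identityʳ; suc-injective; *-assoc; *-identityˡ; *-identityʳ)
open import Algebra.Properties.Semiring.Sum +-*-semiring
  using (sum-syntax; sum-cong-≗; ∑-comm; *-distribˡ-sum; *-distribʳ-sum)
open import Data.Product using (_×_; _,_; proj₁; proj₂)
open import Function using (id; _∘_)
open import Relation.Nullary using (Dec; yes; no; contradiction)
open import Relation.Unary using (Decidable)
open import Relation.Binary.PropositionalEquality
  using (_≡_; refl; sym; trans; cong; cong₂; module ≡-Reasoning)

-- The walk  e P f  is one edge longer than P = W (tgt e) (src f), so its length depends
-- on (e , f) only through the pair of vertices (tgt e , src f). By d-regularity each pair (u , v) of vertices is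
-- hit by exactly d · d pairs of edges, so every walk of length k in W gives d² walks of
-- length k + 1 in the line cover.

indicator : ∀ {p} {P : Set p} → Dec P → ℕ
indicator (yes _) = 1
indicator (no _)  = 0

indicator-cong : ∀ {p q} {P : Set p} {Q : Set q} → (P → Q) → (Q → P) →
                 (p? : Dec P) (q? : Dec Q) → indicator p? ≡ indicator q?
indicator-cong to from (yes p) (yes q) = refl
indicator-cong to from (yes p) (no ¬q) = contradiction (to p) ¬q
indicator-cong to from (no ¬p) (yes q) = contradiction (from q) ¬p
indicator-cong to from (no ¬p) (no ¬q) = refl

∑-indicator-select : ∀ {n} (x : Fin n) (h : Fin n → ℕ) →
                     ∑[ v < n ] (indicator (x ≟ᶠ v) * h v) ≡ h x
∑-indicator-select {suc n} zero    h =
  -- the remaining terms are literally  0 * h (suc v)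
  trans (cong₂ _+_ (*-identityˡ (h zero)) (sym (*-distribˡ-sum 0 (h ∘ suc)))) (+-identityʳ (h zero))
∑-indicator-select {suc n} (suc x) h = trans
  (sum-cong-≗ λ v → cong (_* h (suc v))
    (indicator-cong fsuc-injective (cong suc) (suc x ≟ᶠ suc v) (x ≟ᶠ v)))
  (∑-indicator-select x (h ∘ suc))

length-filter-tabulate : ∀ {a p} {A : Set a} {P : A → Set p} (P? : Decidable P) {n} (h : Fin n → A) →
                         length (filter P? (tabulate h)) ≡ ∑[ i < n ] indicator (P? (h i))
length-filter-tabulate P? {zero}  h = refl
length-filter-tabulate P? {suc n} h with P? (h zero)
... | yes _ = cong suc (length-filter-tabulate P? (h ∘ suc))
... | no  _ = length-filter-tabulate P? (h ∘ suc)

length-filter-cartesianProduct-tabulate :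
  ∀ {a b p} {A : Set a} {B : Set b} {P : A × B → Set p} (P? : Decidable P) {m n}
  (g : Fin m → A) (h : Fin n → B) →
  length (filter P? (cartesianProduct (tabulate g) (tabulate h)))
    ≡ ∑[ i < m ] ∑[ j < n ] indicator (P? (g i , h j))
length-filter-cartesianProduct-tabulate P? {zero}  g h = refl
length-filter-cartesianProduct-tabulate {A = A} {B} P? {suc m} g h = begin
  count (row ++ rest)                         ≡⟨ cong length (filter-++ P? row rest) ⟩
  length (filter P? row ++ filter P? rest)    ≡⟨ length-++ (filter P? row) ⟩
  count row + count rest                      ≡⟨ cong (λ xs → count xs + count rest) (map-tabulate h (g zero ,_)) ⟩
  count (tabulate (λ j → g zero , h j))
    + count rest                              ≡⟨ cong₂ _+_ (length-filter-tabulate P? (λ j → g zero , h j))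
                                                            (length-filter-cartesianProduct-tabulate P? (g ∘ suc) h) ⟩
  ∑[ j < _ ] indicator (P? (g zero , h j))
    + ∑[ i < m ] ∑[ j < _ ] indicator (P? (g (suc i) , h j))  ∎
  where
  open ≡-Reasoning
  count : List (A × B) → ℕ
  count = length ∘ filter P?
  row rest : List (A × B)
  row  = map (g zero ,_) (tabulate h)
  rest = cartesianProduct (tabulate (g ∘ suc)) (tabulate h)

fibreSize : ∀ {m n} → (Fin m → Fin n) → Fin n → ℕ
fibreSize {m} c v = length (filter (λ e → c e ≟ᶠ v) (allFin m))

∑-∘ : ∀ {m n} (c : Fin m → Fin n) (h : Fin n → ℕ) →
      ∑[ e < m ] h (c e) ≡ ∑[ v < n ] (fibreSize c v * h v)
∑-∘ {m} {n} c h = begin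
  ∑[ e < m ] h (c e)                                    ≡⟨ sum-cong-≗ (λ e → sym (∑-indicator-select (c e) h)) ⟩
  ∑[ e < m ] ∑[ v < n ] (indicator (c e ≟ᶠ v) * h v)    ≡⟨ ∑-comm (λ e v → indicator (c e ≟ᶠ v) * h v) ⟩
  ∑[ v < n ] ∑[ e < m ] (indicator (c e ≟ᶠ v) * h v)    ≡⟨ sum-cong-≗ (λ v → sym (*-distribʳ-sum (h v) (λ e → indicator (c e ≟ᶠ v)))) ⟩
  ∑[ v < n ] (∑[ e < m ] indicator (c e ≟ᶠ v) * h v)    ≡⟨ sum-cong-≗ (λ v → cong (_* h v)
                                                             (sym (length-filter-tabulate (λ e → c e ≟ᶠ v) id))) ⟩
  ∑[ v < n ] (fibreSize c v * h v)                      ∎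
  where open ≡-Reasoning

∑-∘-uniformFibres : ∀ {m n d} (c : Fin m → Fin n) → (∀ v → fibreSize c v ≡ d) →
                    (h : Fin n → ℕ) → ∑[ e < m ] h (c e) ≡ d * ∑[ v < n ] h v
∑-∘-uniformFibres {d = d} c fibres h = begin
  ∑[ e < _ ] h (c e)                  ≡⟨ ∑-∘ c h ⟩
  ∑[ v < _ ] (fibreSize c v * h v)    ≡⟨ sum-cong-≗ (λ v → cong (_* h v) (fibres v)) ⟩
  ∑[ v < _ ] (d * h v)                ≡⟨ *-distribˡ-sum d h ⟨
  d * ∑[ v < _ ] h v                  ∎
  where open ≡-Reasoning

∑∑-endpoints-regular : ∀ {n m d} (s t : Fin m → Fin n) → Regular s t d →
  (F : Fin n → Fin n → ℕ) →
  ∑[ e < m ] ∑[ f < m ] F (t e) (s f) ≡ d ^ 2 * ∑[ u < n ] ∑[ v < n ] F u v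
∑∑-endpoints-regular {n} {m} {d} s t regular F = begin
  ∑[ e < m ] ∑[ f < m ] F (t e) (s f)       ≡⟨ sum-cong-≗ (λ e → ∑-∘-uniformFibres s (proj₁ ∘ regular) (F (t e))) ⟩
  ∑[ e < m ] (d * ∑[ v < n ] F (t e) v)     ≡⟨ ∑-∘-uniformFibres t (proj₂ ∘ regular) (λ u → d * ∑[ v < n ] F u v) ⟩
  d * ∑[ u < n ] (d * ∑[ v < n ] F u v)     ≡⟨ cong (d *_) (*-distribˡ-sum d (λ u → ∑[ v < n ] F u v)) ⟨
  d * (d * ∑[ u < n ] ∑[ v < n ] F u v)     ≡⟨ *-assoc d d _ ⟨
  d * d * ∑[ u < n ] ∑[ v < n ] F u v       ≡⟨ cong (λ d² → d * d² * _) (*-identityʳ d) ⟨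
  d ^ 2 * ∑[ u < n ] ∑[ v < n ] F u v       ∎
  where open ≡-Reasoning

wCount≡∑∑-indicator : ∀ {G} n (vtx : Fin n → V G) (W : WalkCover G) k →
  wCount n vtx W k ≡ ∑[ i < n ] ∑[ j < n ] indicator (len (W (vtx i) (vtx j)) ≟ k)
wCount≡∑∑-indicator n vtx W k = length-filter-cartesianProduct-tabulate _ {n} {n} id id

len-ePf : ∀ {G w} (e : E G) (P : Walk G (tgt G e) w) (f : E G) (q : src G f ≡ w) →
          len (ePf {G} e P f q) ≡ suc (len P)
len-ePf e nil          f q = refl
len-ePf e (cons p _ P) f q = cong suc (len-ePf p P f q)

theorem4 : (n m d : ℕ) (s t : Fin m → Fin n) → Regular s t d →
    (W : WalkCover (FinDigraph n m s t)) → (k : ℕ) →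
    wCount {LineGraph (FinDigraph n m s t)} m (λ e → e) (lineCover W) (suc k)
      ≡ d ^ 2 * wCount {FinDigraph n m s t} n (λ v → v) W k
theorem4 n m d s t regular W k = begin
  wCount m id (lineCover W) (suc k)                                  ≡⟨ wCount≡∑∑-indicator m id (lineCover W) (suc k) ⟩
  ∑[ e < m ] ∑[ f < m ] indicator (len (lineCover W e f) ≟ suc k)   ≡⟨ sum-cong-≗ (λ e → sum-cong-≗ (lineCover-hasLength e)) ⟩
  ∑[ e < m ] ∑[ f < m ] hasLength (t e) (s f)                        ≡⟨ ∑∑-endpoints-regular s t regular hasLength ⟩
  d ^ 2 * ∑[ u < n ] ∑[ v < n ] hasLength u v                        ≡⟨ cong (d ^ 2 *_) (wCount≡∑∑-indicator n id W k) ⟨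
  d ^ 2 * wCount n id W k                                            ∎
  where
  open ≡-Reasoning
  G : Digraph
  G = FinDigraph n m s t
  hasLength : Fin n → Fin n → ℕ
  hasLength u v = indicator (len (W u v) ≟ k)
  lineCover-hasLength : ∀ e f → indicator (len (lineCover {G} W e f) ≟ suc k) ≡ hasLength (t e) (s f)
  lineCover-hasLength e f = indicator-cong (suc-injective ∘ trans (sym len-eq)) (trans len-eq ∘ cong suc) _ _
    where
    len-eq : len (lineCover {G} W e f) ≡ suc (len (W (t e) (s f)))
    len-eq = len-ePf {G} e (W (t e) (s f)) f refl
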